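{- Let $n\ge1$, $0\le l\le n$, $N\ge l$, let $\sigma,\mu,\nu$ be $0^{n-l}1^l$-strings, and set $\pi_1=\pi(\sigma,N)$, $\pi_2=\pi'(\mu,N)$, $\pi_3=\pi''(\nu,N)$. Assume $\lambda_2\subseteq\lambda_{\bar 3}$, and let $f:\lambda_1\to D:=\lambda_{\bar3}\setminus\lambda_2$ be a picture. Consider the position obtained from the initial root game position by splitting so that each square containing a $3$-token is its own one-square region and the remaining squares form a single region (the big region). Then in this position: (a) the readiness numbers of the unplaced $1$-tokens are weakly increasing from left to right along each row; (b) they are weakly decreasing going down each column (i.e. as the row index increases); (c) the readiness numbers of the empty squares of $D$ are weakly decreasing from left to right along each row; (d) they are weakly increasing going down each column. Moreover, the Grassmannian root game algorithm (GRGA) preserves properties (a)–(d) throughout its execution.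
   Context: Permutations in one-line notation. For a $0^{n-l}1^l$-string $\sigma$ (string over $\{0,1\}$ with $n-l$ zeros and $l$ ones) with zeros at positions $i_1<\cdots<i_{n-l}$ and ones at $j_1<\cdots<j_l$: $\pi(\sigma,N)=i_1\ldots i_{n-l}\,j_1\ldots j_l\,(n{+}1)\ldots(n{+}N)$; $\pi'(\sigma,N)=(i_1{+}N)\ldots(i_{n-l}{+}N)\,1\,2\ldots N\,(j_1{+}N)\ldots(j_l{+}N)$; $\pi''(\sigma,N)=i_{n-l}\ldots i_1\,(n{+}N)\ldots(n{+}1)\,j_l\ldots j_1$. Root game for $\pi_1,\pi_2,\pi_3\in S_M$, $M=n+N$: squares $S_{ij}$, $1\le i<j\le M$, drawn in an array with row $i$ (row 1 at the top, row index increasing downward) and column $j$ (increasing to the right). Tokens are physical objects with labels; initially a $k$-token is in $S_{ij}$ iff $\pi_k(i)>\pi_k(j)$, and there is one region. Splitting along an ideal subset $A$ (a set of squares with $S_{ij}\in A$, $i'\ge i$, $j'\ge j$ $\Rightarrow S_{i'j'}\in A$) replaces a region $R$ by $R\cap A$ and $R\setminus A$. A move $(R,k,(i,j))$, $i<j$: for each $h>j$ with $S_{jh},S_{ih}\in R$, if $S_{jh}$ has a $k$-token and $S_{ih}$ does not, that token moves to $S_{ih}$; for each $h<i$ with $S_{hi},S_{hj}\in R$, if $S_{hi}$ has a $k$-token and $S_{hj}$ does not, that token moves to $S_{hj}$. The game is won when every square contains exactly one token. Let $\lambda_1$ (resp. $\lambda_2$) be the set of squares initially containing a $1$-token (resp.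 $2$-token), and $\lambda_{\bar3}$ the set of squares not containing a $3$-token; all three lie in the rectangle $\{S_{ij}:i\le n-l<j\}$. Box $A$ is weakly above and weakly right of box $B$ if $A=S_{ij}$, $B=S_{i'j'}$ with $i\le i'$, $j\ge j'$. Lexicographic order: $S_{ij}$ precedes $S_{i'j'}$ if $i<i'$, or $i=i'$ and $j<j'$. A picture $f:\lambda_1\to D$ is a bijection such that whenever distinct $A,B\in\lambda_1$ with $A$ weakly above and weakly right of $B$, $f(A)$ precedes $f(B)$ lexicographically, and whenever distinct $A',B'\in D$ with $A'$ weakly above and weakly right of $B'$, $f^{ -1}(A')$ precedes $f^{ -1}(B')$ lexicographically. Readiness numbers: a $1$-token is placed once it has been moved in Step 3 of the GRGA (it has reached its final destination), otherwise unplaced; an empty square of $D$ is one containing no $1$-token. If an unplaced $1$-token $t$ started in square $S\in\lambda_1$ and currently lies in row $i$, and $f(S)$ lies in row $i'$, the readiness number of $t$ and of the square $f(S)$ is $i-i'$. An unplaced $1$-token or empty square of $D$ is ready if its readiness number is $0$. GRGA (all moves are in the big region with label $1$): Step 1: if some $1$-token is ready go to Step 2; otherwise perform the moves $(1,2),(2,3),\ldots,(n-l-1,n-l)$ (which shift all unplaced $1$-tokens up one row), and repeat until some $1$-token is ready. Step 2: scan the columns of $D$ from the rightmost to the leftmost; in each column take the topmost square not containing a $1$-token; let $S$ be the first such square that is ready. Step 3: choose a ready $1$-token $t$ in the same row as $S$, say in column $i$, with $S$ in column $j$, and make the move (big region, $1$, $(i,j)$), which moves $t$ into $S$ (possibly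 moving other tokens too; all tokens moved here become placed). Step 4: repeat Steps 1–3 until every square of $D$ contains a $1$-token. -}

module Defs where

open import Data.Nat using (ℕ; zero; suc; _+_; _∸_; _≤_; _<_)
open import Data.Bool using (Bool; true; false; _∨_)
open import Data.List using (List; []; _∷_; _++_; map; reverse; upTo; length)
open import Data.Product using (Σ; _×_; _,_; proj₁; proj₂)
open import Data.Sum using (_⊎_)
open import Data.Maybe using (Maybe; just; nothing)
open import Data.Integer as ℤ using (ℤ; +_) renaming (_-_ to _-ℤ_; _≤_ to _≤ℤ_)
open import Relation.Nullary using (¬_)
open import Relation.Binary.PropositionalEquality using (_≡_; _≢_)
open import Relation.Binary.Construct.Closure.ReflexiveTransitive using (Star)

-- Binary strings: false = '0', true = '1'.  Positions are 1-indexed.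

numOnes : List Bool → ℕ
numOnes []           = 0
numOnes (true  ∷ s)  = suc (numOnes s)
numOnes (false ∷ s)  = numOnes s

ZeroOneString : ℕ → ℕ → List Bool → Set
ZeroOneString n l s = (length s ≡ n) × (numOnes s ≡ l)

positionsFrom : Bool → ℕ → List Bool → List ℕ
positionsFrom b k []          = []
positionsFrom true  k (true  ∷ s) = k ∷ positionsFrom true (suc k) s
positionsFrom true  k (false ∷ s) = positionsFrom true (suc k) s
positionsFrom false k (false ∷ s) = k ∷ positionsFrom false (suc k) s
positionsFrom false k (true  ∷ s) = positionsFrom false (suc k) s

zerosOf : List Bool → List ℕ
zerosOf = positionsFrom false 1

onesOf : List Bool → List ℕ
onesOf = positionsFrom true 1

rangeFrom : ℕ → ℕ → List ℕ
rangeFrom a c = map (λ k → a + suc k) (upTo c)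

πPerm : (n N : ℕ) → List Bool → List ℕ
πPerm n N σ = zerosOf σ ++ onesOf σ ++ rangeFrom n N

π′Perm : (n N : ℕ) → List Bool → List ℕ
π′Perm n N σ = map (_+ N) (zerosOf σ) ++ rangeFrom 0 N ++ map (_+ N) (onesOf σ)

π″Perm : (n N : ℕ) → List Bool → List ℕ
π″Perm n N σ = reverse (zerosOf σ) ++ reverse (rangeFrom n N) ++ reverse (onesOf σ)

-- value of a permutation in one-line notation at (1-indexed) position i
at : List ℕ → ℕ → ℕ
at xs       zero          = 0
at []       (suc i)       = 0
at (x ∷ xs) (suc zero)    = x
at (x ∷ xs) (suc (suc i)) = at xs (suc i)

-- Squares S_ij are pairs (i , j) = (row , column).

Sq : Set
Sq = ℕ × ℕ

row col : Sq → ℕ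
row = proj₁
col = proj₂

WAR : Sq → Sq → Set
WAR (i , j) (i′ , j′) = (i ≤ i′) × (j′ ≤ j)

Lex : Sq → Sq → Set
Lex (i , j) (i′ , j′) = (i < i′) ⊎ ((i ≡ i′) × (j < j′))

-- A position of the 1-tokens.  1-tokens are identified by their
-- starting square; 2- and 3-tokens never move in the GRGA (all moves
-- have label 1), and the regions are fixed (see below).
record State : Set where
  field
    pos    : Sq → Sq
    placed : Sq → Bool
open State public

module Game (n l N : ℕ) (σ μ ν : List Bool) (f : Sq → Sq) where

  M : ℕ
  M = n + N

  π₁ π₂ π₃ : List ℕ
  π₁ = πPerm  n N σ
  π₂ = π′Perm n N μ
  π₃ = π″Perm n N ν

  IsSq : Sq → Set
  IsSq (i , j) = (1 ≤ i) × (i < j) × (j ≤ M)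

  token : List ℕ → Sq → Set
  token π (i , j) = IsSq (i , j) × (at π j < at π i)

  λ₁ λ₂ λ̄₃ D : Sq → Set
  λ₁ = token π₁
  λ₂ = token π₂
  λ̄₃ S = IsSq S × ¬ token π₃ S
  D S = λ̄₃ S × ¬ λ₂ S

  Picture : Set
  Picture =
      (∀ A → λ₁ A → D (f A))
    × (∀ A B → λ₁ A → λ₁ B → f A ≡ f B → A ≡ B)
    × (∀ B → D B → Σ Sq λ A → λ₁ A × (f A ≡ B))
    × (∀ A B → λ₁ A → λ₁ B → A ≢ B → WAR A B → Lex (f A) (f B))
    × (∀ A B → λ₁ A → λ₁ B → f A ≢ f B → WAR (f A) (f B) → Lex A B)

  -- After splitting, every 3-token square is its own region and the
  -- remaining squares (those without a 3-token) form the big region.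
  Big : Sq → Set
  Big = λ̄₃

  initial : State
  initial = record { pos = λ S → S ; placed = λ _ → false }

  Occupied : State → Sq → Set
  Occupied st B = Σ Sq λ S → λ₁ S × (pos st S ≡ B)

  Unplaced : State → Sq → Set
  Unplaced st S = placed st S ≡ false

  -- readiness number of the (unplaced) 1-token that started in S,
  -- and of the square f(S)
  rd : State → Sq → ℤ
  rd st S = (+ row (pos st S)) -ℤ (+ row (f S))

  Empty : State → Sq → Set
  Empty st B = D B × ¬ Occupied st B

  ReadyTok : State → Sq → Set
  ReadyTok st S = λ₁ S × Unplaced st S × (rd st S ≡ + 0)

  ReadySq : State → Sq → Set
  ReadySq st B = Empty st B × Σ Sq λ S → λ₁ S × (f S ≡ B) × Unplaced st S × (rd st S ≡ + 0)

  PropA PropB PropC PropD Props : State → Set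
  PropA st = ∀ S S′ → λ₁ S → λ₁ S′ → Unplaced st S → Unplaced st S′ →
    row (pos st S) ≡ row (pos st S′) → col (pos st S) < col (pos st S′) →
    rd st S ≤ℤ rd st S′
  PropB st = ∀ S S′ → λ₁ S → λ₁ S′ → Unplaced st S → Unplaced st S′ →
    col (pos st S) ≡ col (pos st S′) → row (pos st S) < row (pos st S′) →
    rd st S′ ≤ℤ rd st S
  PropC st = ∀ S S′ → λ₁ S → λ₁ S′ → Unplaced st S → Unplaced st S′ →
    Empty st (f S) → Empty st (f S′) →
    row (f S) ≡ row (f S′) → col (f S) < col (f S′) →
    rd st S′ ≤ℤ rd st S
  PropD st = ∀ S S′ → λ₁ S → λ₁ S′ → Unplaced st S → Unplaced st S′ →
    Empty st (f S) → Empty st (f S′) →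
    col (f S) ≡ col (f S′) → row (f S) < row (f S′) →
    rd st S ≤ℤ rd st S′
  Props st = PropA st × PropB st × PropC st × PropD st

  -- move (big region, 1, (i,j)), i < j: the 1-token in square X moves to Y
  MovesTo : State → ℕ → ℕ → Sq → Sq → Set
  MovesTo st i j (a , b) Y =
      (((a ≡ j) × (j < b) × (Y ≡ (i , b))) ⊎ ((b ≡ i) × (a < i) × (Y ≡ (a , j))))
    × Big (a , b) × Big Y × ¬ Occupied st Y

  -- st′ results from st by the move (big region, 1, (i,j));
  -- if mark = true the moved tokens become placed.
  Move : Bool → State → ℕ → ℕ → State → Set
  Move mark st i j st′ = (i < j) × (∀ S → λ₁ S →
      (∀ Y → MovesTo st i j (pos st S) Y →
           (pos st′ S ≡ Y) × (placed st′ S ≡ (mark ∨ placed st S)))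
    × (¬ (Σ Sq λ Y → MovesTo st i j (pos st S) Y) →
           (pos st′ S ≡ pos st S) × (placed st′ S ≡ placed st S)))

  data Shifts : ℕ → State → State → Set where
    none : ∀ {s} → Shifts 0 s s
    more : ∀ {k s s′ s″} → Shifts k s s′ → Move false s′ (suc k) (suc (suc k)) s″ →
           Shifts (suc k) s s″

  Done : State → Set
  Done st = ∀ B → D B → Occupied st B

  TopEmpty : State → Sq → Set
  TopEmpty st B = Empty st B ×
    (∀ r → r < row B → D (r , col B) → Occupied st (r , col B))

  -- one iteration of the GRGA: either Step 1 (a shift of all rows,
  -- when no 1-token is ready) or Steps 2-3 (placing one token)
  data GStep (st : State) : State → Set where
    shift : ∀ {st′} → ¬ Done st →
      ¬ (Σ Sq λ S → ReadyTok st S) →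
      Shifts ((n ∸ l) ∸ 1) st st′ → GStep st st′
    place : ∀ {st′} → ¬ Done st →
      (B : Sq) → TopEmpty st B → ReadySq st B →
      (∀ B′ → TopEmpty st B′ → col B < col B′ → ¬ ReadySq st B′) →
      (T : Sq) → ReadyTok st T → row (pos st T) ≡ row B →
      Move true st (col (pos st T)) (col B) st′ → GStep st st′

  Reachable : State → Set
  Reachable = Star GStep initial

{-# OPTIONS --safe #-}

-- Only 1-tokens move, and every token moved in Steps 2-3 becomes placed, in a
-- column of D right of column n.  So throughout the GRGA the unplaced tokens
-- sit at their starting squares shifted up by a common number t of rows: a
-- Step 1 round happens only when no token is ready, so each unplaced token is
-- strictly below the row of its target, and the moves (1,2), …, (n-l-1,n-l)
-- lift every one of them by one row.  The readiness number of the token that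
-- started at S is therefore row S − row f(S) − t, and (a)-(d) become facts
-- about the picture f alone: (a) and (c) follow from the lexicographic
-- conditions for f and for f⁻¹, and (b) and (d) from these together with the
-- convexity of the columns of λ₁ and of D, which forces f, resp. f⁻¹, to
-- spread the squares of a column at least as far apart as they were.

module Submission where

open import Defs
open import Data.Bool using (Bool; true; false; _∨_)
import Data.Bool.Properties as Bool
open import Data.Empty using (⊥; ⊥-elim)
import Data.Integer as ℤ
open import Data.Integer using (_⊖_)
import Data.Integer.Properties as ℤ
open import Data.List using (List; []; _∷_; _++_; length; map; reverse; upTo)
open import Data.List.Properties using (length-++; length-map; length-upTo; length-reverse; unfold-reverse)
open import Data.List.Relation.Unary.All as All using (All; []; _∷_)
import Data.List.Relation.Unary.All.Properties as All
open import Data.List.Relation.Unary.AllPairs as AllPairs using (AllPairs; []; _∷_)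
import Data.List.Relation.Unary.AllPairs.Properties as AllPairs
open import Data.Nat using (ℕ; zero; suc; z<s; _+_; _∸_; _≤_; _<_; z≤n; s≤s; _≤?_; _<?_)
open import Data.Nat.Properties
open import Algebra.Properties.CommutativeSemigroup +-commutativeSemigroup using (xy∙z≈xz∙y)
open import Data.Product using (Σ; _×_; _,_; proj₁; proj₂; uncurry)
open import Data.Sum using (inj₁; inj₂)
open import Function using (flip; case_of_)
open import Relation.Binary.Construct.Closure.ReflexiveTransitive using (Star; ε; _◅_)
open import Relation.Binary.PropositionalEquality
open import Relation.Nullary using (¬_; Dec; yes; no)
open import Relation.Nullary.Decidable using (decidable-stable)

at-All : ∀ {P : ℕ → Set} {xs i} → All P xs → 1 ≤ i → i ≤ length xs → P (at xs i)
at-All {i = suc zero}    (px ∷ _)   _ _       = px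
at-All {i = suc (suc i)} (_  ∷ pxs) _ (s≤s h) = at-All pxs (s≤s z≤n) h

at-AllPairs : ∀ {R : ℕ → ℕ → Set} {xs i j} → AllPairs R xs →
              1 ≤ i → i < j → j ≤ length xs → R (at xs i) (at xs j)
at-AllPairs {i = suc zero}    {suc zero}    _         _ (s≤s ()) _
at-AllPairs {i = suc zero}    {suc (suc j)} (rx ∷ _)  _ _ (s≤s h) = at-All rx (s≤s z≤n) h
at-AllPairs {i = suc (suc i)} {suc (suc j)} (_ ∷ rxs) _ (s≤s i<j) (s≤s h) =
  at-AllPairs rxs (s≤s z≤n) i<j h

at-++ˡ : ∀ xs ys {i} → i ≤ length xs → at (xs ++ ys) i ≡ at xs i
at-++ˡ xs       ys {zero}        _       = refl
at-++ˡ (x ∷ xs) ys {suc zero}    _       = refl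
at-++ˡ (x ∷ xs) ys {suc (suc i)} (s≤s h) = at-++ˡ xs ys h

at-++ʳ : ∀ xs ys {i} → length xs < i → at (xs ++ ys) i ≡ at ys (i ∸ length xs)
at-++ʳ []       ys                 _       = refl
at-++ʳ (x ∷ xs) ys {suc (suc i)} (s≤s h) = at-++ʳ xs ys h

Segment : List ℕ → List ℕ → ℕ → Set
Segment L X o = ∀ {i} → o < i → i ≤ o + length X → at L i ≡ at X (i ∸ o)

segment-whole : ∀ L → Segment L L 0
segment-whole L _ _ = refl

segment-prefix : ∀ {L X Y o} → Segment L (X ++ Y) o → Segment L X o
segment-prefix {X = X} {Y} {o} seg {i} o<i i≤ =
  trans (seg o<i (≤-trans i≤ (+-monoʳ-≤ o (≤-trans (m≤m+n _ _) (≤-reflexive (sym (length-++ X)))))))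
        (at-++ˡ X Y (m≤n+o⇒m∸n≤o i o i≤))

segment-suffix : ∀ {L X Y o} → Segment L (X ++ Y) o → Segment L Y (o + length X)
segment-suffix {L} {X} {Y} {o} seg {i} o+x<i i≤ = begin
  at L i                    ≡⟨ seg o<i (≤-trans i≤ (≤-reflexive (trans (+-assoc o _ _) (cong (o +_) (sym (length-++ X)))))) ⟩
  at (X ++ Y) (i ∸ o)       ≡⟨ at-++ʳ X Y (subst (_< i ∸ o) (m+n∸m≡n o _) (∸-monoˡ-< o+x<i (m≤m+n o _))) ⟩
  at Y (i ∸ o ∸ length X)   ≡⟨ cong (at Y) (∸-+-assoc i o _) ⟩
  at Y (i ∸ (o + length X)) ∎
  where
  open ≡-Reasoning
  o<i : o < i
  o<i = ≤-<-trans (m≤m+n o _) o+x<i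

module _ {L X : List ℕ} {o : ℕ} (seg : Segment L X o) where

  segment-All : ∀ {P : ℕ → Set} {i} → All P X → o < i → i ≤ o + length X → P (at L i)
  segment-All {P} {i} pX o<i i≤ =
    subst P (sym (seg o<i i≤)) (at-All pX (m<n⇒0<n∸m o<i) (m≤n+o⇒m∸n≤o i o i≤))

  segment-AllPairs : ∀ {R : ℕ → ℕ → Set} {i j} → AllPairs R X →
                     o < i → i < j → j ≤ o + length X → R (at L i) (at L j)
  segment-AllPairs {R} {i} {j} rX o<i i<j j≤ =
    subst₂ R (sym (seg o<i (≤-trans (<⇒≤ i<j) j≤))) (sym (seg (<-trans o<i i<j) j≤))
      (at-AllPairs rX (m<n⇒0<n∸m o<i) (∸-monoˡ-< i<j (<⇒≤ o<i)) (m≤n+o⇒m∸n≤o j o j≤))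

All-reverse : ∀ {P : ℕ → Set} {xs} → All P xs → All P (reverse xs)
All-reverse {xs = []}     []         = []
All-reverse {xs = x ∷ xs} (px ∷ pxs) rewrite unfold-reverse x xs = All.∷ʳ⁺ (All-reverse pxs) px

AllPairs-reverse : ∀ {R : ℕ → ℕ → Set} {xs} → AllPairs R xs → AllPairs (flip R) (reverse xs)
AllPairs-reverse {xs = []}     []         = []
AllPairs-reverse {xs = x ∷ xs} (rx ∷ rxs) rewrite unfold-reverse x xs =
  AllPairs.++⁺ (AllPairs-reverse rxs) ([] ∷ []) (All.map (_∷ []) (All-reverse rx))

widen-bounds : ∀ {k m xs} → All (λ x → suc k ≤ x × x < suc k + m) xs → All (λ x → k ≤ x × x < k + suc m) xs
widen-bounds {k} {m} = All.map λ (k<x , x<) → <⇒≤ k<x , ≤-trans x< (≤-reflexive (sym (+-suc k m)))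

length-positionsFrom-true : ∀ k s → length (positionsFrom true k s) ≡ numOnes s
length-positionsFrom-true k []          = refl
length-positionsFrom-true k (true  ∷ s) = cong suc (length-positionsFrom-true (suc k) s)
length-positionsFrom-true k (false ∷ s) = length-positionsFrom-true (suc k) s

length-positionsFrom-false : ∀ k s → length (positionsFrom false k s) + numOnes s ≡ length s
length-positionsFrom-false k []          = refl
length-positionsFrom-false k (true  ∷ s) =
  trans (+-suc _ (numOnes s)) (cong suc (length-positionsFrom-false (suc k) s))
length-positionsFrom-false k (false ∷ s) = cong suc (length-positionsFrom-false (suc k) s)

positionsFrom-bounded : ∀ b k s → All (λ x → k ≤ x × x < k + length s) (positionsFrom b k s)
positionsFrom-bounded b     k []          = []
positionsFrom-bounded true  k (true  ∷ s) = (≤-refl , m<m+n k z<s) ∷ widen-bounds (positionsFrom-bounded true (suc k) s)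
positionsFrom-bounded true  k (false ∷ s) = widen-bounds (positionsFrom-bounded true (suc k) s)
positionsFrom-bounded false k (false ∷ s) = (≤-refl , m<m+n k z<s) ∷ widen-bounds (positionsFrom-bounded false (suc k) s)
positionsFrom-bounded false k (true  ∷ s) = widen-bounds (positionsFrom-bounded false (suc k) s)

positionsFrom-sorted : ∀ b k s → AllPairs _<_ (positionsFrom b k s)
positionsFrom-sorted b     k []          = []
positionsFrom-sorted true  k (true  ∷ s) =
  All.map proj₁ (positionsFrom-bounded true (suc k) s) ∷ positionsFrom-sorted true (suc k) s
positionsFrom-sorted true  k (false ∷ s) = positionsFrom-sorted true (suc k) s
positionsFrom-sorted false k (false ∷ s) =
  All.map proj₁ (positionsFrom-bounded false (suc k) s) ∷ positionsFrom-sorted false (suc k) s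
positionsFrom-sorted false k (true  ∷ s) = positionsFrom-sorted false (suc k) s

rangeFrom-bounded : ∀ a c → All (λ x → a < x × x ≤ a + c) (rangeFrom a c)
rangeFrom-bounded a c = All.map⁺ (All.applyUpTo⁺₁ _ c (λ k<c → m<m+n a z<s , +-monoʳ-≤ a k<c))

rangeFrom-sorted : ∀ a c → AllPairs _<_ (rangeFrom a c)
rangeFrom-sorted a c = AllPairs.map⁺ (AllPairs.applyUpTo⁺₁ _ c (λ i<j _ → +-monoʳ-< a (s≤s i<j)))

length-rangeFrom : ∀ a c → length (rangeFrom a c) ≡ c
length-rangeFrom a c = trans (length-map _ (upTo c)) (length-upTo c)

m-n≤o-p : ∀ m n o p → m + p ≤ o + n → ℤ.+ m ℤ.- ℤ.+ n ℤ.≤ ℤ.+ o ℤ.- ℤ.+ p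
m-n≤o-p m n o p m+p≤o+n = subst₂ ℤ._≤_ (sym (ℤ.m-n≡m⊖n m n)) (sym (ℤ.m-n≡m⊖n o p)) (begin
  m ⊖ n             ≡⟨ sym (ℤ.+-cancelˡ-⊖ p m n) ⟩
  (p + m) ⊖ (p + n) ≡⟨ cong₂ _⊖_ (+-comm p m) (+-comm p n) ⟩
  (m + p) ⊖ (n + p) ≤⟨ ℤ.⊖-monoˡ-≤ (n + p) m+p≤o+n ⟩
  (o + n) ⊖ (n + p) ≡⟨ cong (_⊖ (n + p)) (+-comm o n) ⟩
  (n + o) ⊖ (n + p) ≡⟨ ℤ.+-cancelˡ-⊖ n o p ⟩
  o ⊖ p             ∎)
  where open ℤ.≤-Reasoning

-- The rows a and a′ of a token (with a ≥ 2) before and after the moves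
-- (1,2), …, (k,k+1), which raise rows 2, …, k+1 by one in turn.
RaisedUpTo : ℕ → ℕ → ℕ → Set
RaisedUpTo k a a′ = (a ≤ suc k → suc a′ ≡ a) × (suc k < a → a′ ≡ a)

raised-start : ∀ {a} → 2 ≤ a → RaisedUpTo 0 a a
raised-start 2≤a = (λ a≤1 → ⊥-elim (<⇒≱ 2≤a a≤1)) , (λ _ → refl)

raised-avoids : ∀ {k a a′} → 2 ≤ a → RaisedUpTo k a a′ → a′ ≢ suc k
raised-avoids {k} {a} 2≤a (low , high) refl with a ≤? suc k
... | yes a≤k+1 = <⇒≱ (≤-reflexive (low a≤k+1)) a≤k+1
... | no a≰k+1  = <-irrefl (high (≰⇒> a≰k+1)) (≰⇒> a≰k+1)

raised-move : ∀ {k a} → RaisedUpTo k a (suc (suc k)) → RaisedUpTo (suc k) a (suc k)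
raised-move {k} {a} (low , high) with a ≤? suc k
... | yes a≤k+1 = ⊥-elim (<⇒≱ (≤-reflexive (low a≤k+1)) (≤-trans a≤k+1 (n≤1+n _)))
... | no a≰k+1  = (λ _ → sym a≡k+2) , (λ k+2<a → ⊥-elim (<-irrefl (sym a≡k+2) k+2<a))
  where
  a≡k+2 : a ≡ suc (suc k)
  a≡k+2 = sym (high (≰⇒> a≰k+1))

raised-stay : ∀ {k a a′} → RaisedUpTo k a a′ → a′ ≢ suc (suc k) → RaisedUpTo (suc k) a a′
raised-stay {k} {a} {a′} (low , high) a′≢k+2 = low′ , (λ k+2<a → high (<-trans (n<1+n _) k+2<a))
  where
  low′ : a ≤ suc (suc k) → suc a′ ≡ a
  low′ a≤k+2 with m≤n⇒m<n∨m≡n a≤k+2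
  ... | inj₁ a<k+2 = low (≤-pred a<k+2)
  ... | inj₂ a≡k+2 = ⊥-elim (a′≢k+2 (trans (high (≤-reflexive (sym a≡k+2))) a≡k+2))

<∸1⇒suc< : ∀ {k r} → k < r ∸ 1 → suc k < r
<∸1⇒suc< {r = suc r} k<r = s≤s k<r

module ZeroOneStringFacts {n l : ℕ} (l≤n : l ≤ n) (s : List Bool) (s-ok : ZeroOneString n l s) where

  length-zeros : length (zerosOf s) ≡ n ∸ l
  length-zeros = begin
    length (zerosOf s)                ≡⟨ sym (m+n∸n≡m _ l) ⟩
    length (zerosOf s) + l ∸ l        ≡⟨ cong (λ k → length (zerosOf s) + k ∸ l) (sym (proj₂ s-ok)) ⟩
    length (zerosOf s) + numOnes s ∸ l ≡⟨ cong (_∸ l) (trans (length-positionsFrom-false 1 s) (proj₁ s-ok)) ⟩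
    n ∸ l                             ∎
    where open ≡-Reasoning

  length-ones : length (onesOf s) ≡ l
  length-ones = trans (length-positionsFrom-true 1 s) (proj₂ s-ok)

  positions-bounded : ∀ b → All (λ x → 1 ≤ x × x ≤ n) (positionsFrom b 1 s)
  positions-bounded b = All.map (λ (1≤x , x≤) → 1≤x , ≤-pred (subst (λ m → _ < suc m) (proj₁ s-ok) x≤))
                                (positionsFrom-bounded b 1 s)

module OneLineFacts {n l : ℕ} (N : ℕ) (l≤n : l ≤ n) (s : List Bool) (s-ok : ZeroOneString n l s) where

  open ZeroOneStringFacts l≤n s s-ok

  r : ℕ
  r = n ∸ l

  private
    Z O R : List ℕ
    Z = zerosOf s
    O = onesOf s
    R = rangeFrom n N

    r+l≡n : r + l ≡ n
    r+l≡n = m∸n+n≡m l≤n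

    r+[l+N]≡n+N : r + (l + N) ≡ n + N
    r+[l+N]≡n+N = trans (sym (+-assoc r l N)) (cong (_+ N) r+l≡n)

    zeros≤n : All (_≤ n) Z
    zeros≤n = All.map proj₂ (positions-bounded false)

    ones≤n : All (_≤ n) O
    ones≤n = All.map proj₂ (positions-bounded true)

    range>n : All (n <_) R
    range>n = All.map proj₁ (rangeFrom-bounded n N)

    below-range : ∀ {xs} → All (_≤ n) xs → All (λ x → All (x <_) R) xs
    below-range = All.map (λ x≤n → All.map (≤-<-trans x≤n) range>n)

    zeros-sorted ones-sorted : AllPairs _<_ (positionsFrom _ 1 s)
    zeros-sorted = positionsFrom-sorted false 1 s
    ones-sorted  = positionsFrom-sorted true 1 s

    π-zeros : Segment (πPerm n N s) Z 0
    π-zeros = segment-prefix {X = Z} {Y = O ++ R} (segment-whole _)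

    π-tail : Segment (πPerm n N s) (O ++ R) r
    π-tail = subst (Segment _ (O ++ R)) length-zeros (segment-suffix {X = Z} (segment-whole _))

    π-range : Segment (πPerm n N s) R n
    π-range = subst (Segment _ R) (trans (cong₂ _+_ length-zeros length-ones) r+l≡n)
                    (segment-suffix {X = O} (segment-suffix {X = Z} (segment-whole _)))

    length-tail : r + length (O ++ R) ≡ n + N
    length-tail =
      trans (cong (r +_) (trans (length-++ O) (cong₂ _+_ length-ones (length-rangeFrom n N)))) r+[l+N]≡n+N

  πPerm-increasing : ∀ {i j} → 1 ≤ i → i < j → j ≤ r → at (πPerm n N s) i < at (πPerm n N s) j
  πPerm-increasing 1≤i i<j j≤r =
    segment-AllPairs π-zeros zeros-sorted 1≤i i<j (subst (_ ≤_) (sym length-zeros) j≤r)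

  πPerm-inversion : ∀ {i j} → 1 ≤ i → i < j → j ≤ n + N →
                    at (πPerm n N s) j < at (πPerm n N s) i → i ≤ r × r < j × j ≤ n
  πPerm-inversion {i} {j} 1≤i i<j j≤ inv with i ≤? r
  ... | no i≰r = ⊥-elim (<-asym inv
        (segment-AllPairs π-tail (AllPairs.++⁺ ones-sorted (rangeFrom-sorted n N) (below-range ones≤n))
                          (≰⇒> i≰r) i<j (subst (j ≤_) (sym length-tail) j≤)))
  ... | yes i≤r with j ≤? r
  ...   | yes j≤r = ⊥-elim (<-asym inv (πPerm-increasing 1≤i i<j j≤r))
  ...   | no j≰r with j ≤? n
  ...     | yes j≤n = i≤r , ≰⇒> j≰r , j≤n
  ...     | no j≰n = ⊥-elim (<-asym inv (≤-<-trans
              (segment-All π-zeros zeros≤n 1≤i (subst (i ≤_) (sym length-zeros) i≤r))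
              (segment-All π-range range>n (≰⇒> j≰n)
                           (subst (j ≤_) (cong (n +_) (sym (length-rangeFrom n N))) j≤))))

  private
    Z+N : List ℕ
    Z+N = map (_+ N) Z

    length-Z+N : length Z+N ≡ r
    length-Z+N = trans (length-map (_+ N) Z) length-zeros

    π′-zeros : Segment (π′Perm n N s) Z+N 0
    π′-zeros = segment-prefix {Y = rangeFrom 0 N ++ map (_+ N) O} (segment-whole _)

    π′-range : Segment (π′Perm n N s) (rangeFrom 0 N) r
    π′-range = subst (Segment _ _) length-Z+N
      (segment-prefix {Y = map (_+ N) O} (segment-suffix {X = Z+N} (segment-whole _)))

  π′Perm-increasing : ∀ {i j} → 1 ≤ i → i < j → j ≤ r → at (π′Perm n N s) i < at (π′Perm n N s) j
  π′Perm-increasing 1≤i i<j j≤r =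
    segment-AllPairs π′-zeros (AllPairs.map⁺ {R = _<_} (AllPairs.map (+-monoˡ-< N) zeros-sorted))
                     1≤i i<j (subst (_ ≤_) (sym length-Z+N) j≤r)

  π′Perm-zeros>range : ∀ {i j} → 1 ≤ i → i ≤ r → r < j → j ≤ r + N →
                       at (π′Perm n N s) j < at (π′Perm n N s) i
  π′Perm-zeros>range {i} {j} 1≤i i≤r r<j j≤ = ≤-<-trans
    (proj₂ (segment-All π′-range (rangeFrom-bounded 0 N) r<j
                        (subst (λ m → j ≤ r + m) (sym (length-rangeFrom 0 N)) j≤)))
    (segment-All π′-zeros
                 (All.map⁺ {P = N <_} (All.map (λ (1≤x , _) → +-monoˡ-≤ N 1≤x) (positions-bounded false)))
                 1≤i (subst (i ≤_) (sym length-Z+N) i≤r))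

  private
    length-reverse-zeros : length (reverse Z) ≡ r
    length-reverse-zeros = trans (length-reverse Z) length-zeros

    length-reverse-range : length (reverse R) ≡ N
    length-reverse-range = trans (length-reverse R) (length-rangeFrom n N)

    length-reverse-tail : r + length (reverse R ++ reverse O) ≡ n + N
    length-reverse-tail = begin
      r + length (reverse R ++ reverse O)           ≡⟨ cong (r +_) (length-++ (reverse R)) ⟩
      r + (length (reverse R) + length (reverse O)) ≡⟨ cong (λ m → r + (m + _)) length-reverse-range ⟩
      r + (N + length (reverse O))                  ≡⟨ cong (λ m → r + (N + m)) (trans (length-reverse O) length-ones) ⟩
      r + (N + l)                                   ≡⟨ cong (r +_) (+-comm N l) ⟩
      r + (l + N)                                   ≡⟨ r+[l+N]≡n+N ⟩
      n + N                                         ∎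
      where open ≡-Reasoning

    π″-zeros : Segment (π″Perm n N s) (reverse Z) 0
    π″-zeros = segment-prefix {Y = reverse R ++ reverse O} (segment-whole _)

    π″-tail : Segment (π″Perm n N s) (reverse R ++ reverse O) r
    π″-tail = subst (Segment _ _) length-reverse-zeros (segment-suffix {X = reverse Z} (segment-whole _))

    π″-range : Segment (π″Perm n N s) (reverse R) r
    π″-range = segment-prefix {Y = reverse O} π″-tail

  π″Perm-decreasing : ∀ {i j} → 1 ≤ i → i < j → j ≤ r → at (π″Perm n N s) j < at (π″Perm n N s) i
  π″Perm-decreasing 1≤i i<j j≤r =
    segment-AllPairs π″-zeros (AllPairs-reverse zeros-sorted) 1≤i i<j
                     (subst (_ ≤_) (sym length-reverse-zeros) j≤r)

  π″Perm-zeros<range : ∀ {i j} → 1 ≤ i → i ≤ r → r < j → j ≤ r + N →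
                       at (π″Perm n N s) i < at (π″Perm n N s) j
  π″Perm-zeros<range {i} {j} 1≤i i≤r r<j j≤ = ≤-<-trans
    (segment-All π″-zeros (All-reverse zeros≤n) 1≤i (subst (i ≤_) (sym length-reverse-zeros) i≤r))
    (segment-All π″-range (All-reverse range>n) r<j
                 (subst (λ m → j ≤ r + m) (sym length-reverse-range) j≤))

  π″Perm-non-inversion : ∀ {i j} → 1 ≤ i → i < j → j ≤ n + N →
                         ¬ (at (π″Perm n N s) j < at (π″Perm n N s) i) → i ≤ r × r < j
  π″Perm-non-inversion {i} {j} 1≤i i<j j≤ non-inv with i ≤? r
  ... | no i≰r = ⊥-elim (non-inv
        (segment-AllPairs π″-tail
          (AllPairs.++⁺ (AllPairs-reverse (rangeFrom-sorted n N)) (AllPairs-reverse ones-sorted)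
            (All-reverse (All.map (λ n<x → All.map (λ y≤n → ≤-<-trans y≤n n<x) (All-reverse ones≤n)) range>n)))
          (≰⇒> i≰r) i<j (subst (j ≤_) (sym length-reverse-tail) j≤)))
  ... | yes i≤r with j ≤? r
  ...   | yes j≤r = ⊥-elim (non-inv (π″Perm-decreasing 1≤i i<j j≤r))
  ...   | no j≰r = i≤r , ≰⇒> j≰r

ColumnConvex : (Sq → Set) → Set
ColumnConvex X = ∀ {a b k c} → X (a , c) → X (b , c) → a ≤ k → k ≤ b → X (k , c)

-- A picture presented as a relation F between its domain X and codomain Y,
-- so that it and its inverse are treated alike.
record IsPicture (X Y : Sq → Set) (F : Sq → Sq → Set) : Set where
  field
    domain       : ∀ {A A′} → F A A′ → X A
    codomain     : ∀ {A A′} → F A A′ → Y A′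
    total        : ∀ {A} → X A → Σ Sq (F A)
    onto         : ∀ {A′} → Y A′ → Σ Sq (λ A → F A A′)
    lex-image    : ∀ {A B A′ B′} → F A A′ → F B B′ → A ≢ B → WAR A B → Lex A′ B′
    lex-preimage : ∀ {A B A′ B′} → F A A′ → F B B′ → A′ ≢ B′ → WAR A′ B′ → Lex A B

converse : ∀ {X Y F} → IsPicture X Y F → IsPicture Y X (flip F)
converse P = record
  { domain       = codomain
  ; codomain     = domain
  ; total        = onto
  ; onto         = total
  ; lex-image    = lex-preimage
  ; lex-preimage = lex-image
  }
  where open IsPicture P

Lex⇒row≤ : ∀ {A B} → Lex A B → row A ≤ row B
Lex⇒row≤ (inj₁ i<i′)     = <⇒≤ i<i′
Lex⇒row≤ (inj₂ (i≡i′ , _)) = ≤-reflexive i≡i′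

module PictureFacts {X Y F} (P : IsPicture X Y F) where

  open IsPicture P

  row-antitone : ∀ {A B A′ B′} → F A A′ → F B B′ → row A ≡ row B → col A < col B → row B′ ≤ row A′
  row-antitone FA FB rows cA<cB = Lex⇒row≤
    (lex-image FB FA (λ B≡A → <-irrefl (cong col (sym B≡A)) cA<cB) (≤-reflexive (sym rows) , <⇒≤ cA<cB))

  column-strict : ∀ {A B A′ B′} → F A A′ → F B B′ → col A ≡ col B → row A < row B → row A′ < row B′
  column-strict FA FB cols rA<rB
    with lex-image FA FB (λ A≡B → <-irrefl (cong row A≡B) rA<rB) (<⇒≤ rA<rB , ≤-reflexive (sym cols))
  ... | inj₁ rA′<rB′          = rA′<rB′
  ... | inj₂ (rows′ , cA′<cB′) = ⊥-elim (<⇒≱ rA<rB (Lex⇒row≤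
          (lex-preimage FB FA (λ B′≡A′ → <-irrefl (cong col (sym B′≡A′)) cA′<cB′)
                           (≤-reflexive (sym rows′) , <⇒≤ cA′<cB′))))

  -- i.e. row B′ − row A′ ≥ row B − row A, stated without subtraction
  column-gap : ColumnConvex X → ∀ {A B A′ B′} → F A A′ → F B B′ → col A ≡ col B → row A < row B →
               row A′ + row B ≤ row B′ + row A
  column-gap convex {a , c} {b , .c} FA FB refl = gap FA FB
    where
    gap : ∀ {a b A′ B′} → F (a , c) A′ → F (b , c) B′ → a < b → row A′ + b ≤ row B′ + a
    gap {a} {suc b} {A′} {B′} FA FB (s≤s a≤b) with m≤n⇒m<n∨m≡n a≤b
    ... | inj₂ refl = begin
      row A′ + suc a   ≡⟨ +-suc (row A′) a ⟩
      suc (row A′ + a) ≤⟨ +-monoˡ-≤ a (column-strict FA FB refl ≤-refl) ⟩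
      row B′ + a       ∎
      where open ≤-Reasoning
    ... | inj₁ a<b = begin
      row A′ + suc b   ≡⟨ +-suc (row A′) b ⟩
      suc (row A′ + b) ≤⟨ s≤s (gap FA FC a<b) ⟩
      suc (row C′ + a) ≤⟨ +-monoˡ-≤ a (column-strict FC FB refl ≤-refl) ⟩
      row B′ + a       ∎
      where
      open ≤-Reasoning
      C′ : Sq
      C′ = proj₁ (total (convex (domain FA) (domain FB) (<⇒≤ a<b) (n≤1+n b)))
      FC : F (b , c) C′
      FC = proj₂ (total (convex (domain FA) (domain FB) (<⇒≤ a<b) (n≤1+n b)))

module Shape {n l N : ℕ} (l≤n : l ≤ n) (l≤N : l ≤ N) (σ μ ν : List Bool)
  (σ-ok : ZeroOneString n l σ) (μ-ok : ZeroOneString n l μ) (ν-ok : ZeroOneString n l ν)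
  (f : Sq → Sq) where

  open Game n l N σ μ ν f
  open OneLineFacts N l≤n σ σ-ok public using (r)
  private
    module σ = OneLineFacts N l≤n σ σ-ok
    module μ = OneLineFacts N l≤n μ μ-ok
    module ν = OneLineFacts N l≤n ν ν-ok

    n≤r+N : n ≤ r + N
    n≤r+N = subst (_≤ r + N) (m∸n+n≡m l≤n) (+-monoʳ-≤ r l≤N)

  λ₁-rect : ∀ {a c} → λ₁ (a , c) → 1 ≤ a × a ≤ r × r < c × c ≤ n
  λ₁-rect ((1≤a , a<c , c≤M) , inv) = 1≤a , σ.πPerm-inversion 1≤a a<c c≤M inv

  λ₁-down : ∀ {a c k} → λ₁ (a , c) → a ≤ k → k ≤ r → λ₁ (k , c)
  λ₁-down {a} {c} {k} S∈λ₁@((1≤a , _ , c≤M) , inv) a≤k k≤r =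
    (≤-trans 1≤a a≤k , <-≤-trans (s≤s k≤r) (proj₁ (proj₂ (proj₂ (λ₁-rect S∈λ₁)))) , c≤M) ,
    ≤-trans inv π₁-a≤k
    where
    π₁-a≤k : at π₁ a ≤ at π₁ k
    π₁-a≤k with m≤n⇒m<n∨m≡n a≤k
    ... | inj₁ a<k  = <⇒≤ (σ.πPerm-increasing 1≤a a<k k≤r)
    ... | inj₂ refl = ≤-refl

  λ₁-column-convex : ColumnConvex λ₁
  λ₁-column-convex A∈λ₁ B∈λ₁ a≤k k≤b = λ₁-down A∈λ₁ a≤k (≤-trans k≤b (proj₁ (proj₂ (λ₁-rect B∈λ₁))))

  D-rect : ∀ {x y} → D (x , y) → 1 ≤ x × x ≤ r × n < y
  D-rect {x} {y} ((xy@(1≤x , x<y , y≤M) , no-3) , no-2)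
    with ν.π″Perm-non-inversion 1≤x x<y y≤M (λ inv → no-3 (xy , inv))
  ... | x≤r , r<y with y ≤? r + N
  ...   | yes y≤r+N = ⊥-elim (no-2 (xy , μ.π′Perm-zeros>range 1≤x x≤r r<y y≤r+N))
  ...   | no y≰r+N  = 1≤x , x≤r , <-≤-trans (s≤s n≤r+N) (≰⇒> y≰r+N)

  D-column-convex : ColumnConvex D
  D-column-convex {a} {b} {k} {c} (((1≤a , _ , c≤M) , no-3) , _) B∈D@((bc@(_ , b<c , _) , _) , no-2) a≤k k≤b =
    (kc , λ (_ , inv) → no-3 ((1≤a , ≤-<-trans (≤-trans a≤k k≤b) b<c , c≤M) , <-≤-trans inv π₃-a≥k)) ,
    (λ (_ , inv) → no-2 (bc , <-≤-trans inv π₂-k≤b))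
    where
    kc : IsSq (k , c)
    kc = ≤-trans 1≤a a≤k , ≤-<-trans k≤b b<c , c≤M
    b≤r : b ≤ r
    b≤r = proj₁ (proj₂ (D-rect B∈D))
    π₃-a≥k : at π₃ k ≤ at π₃ a
    π₃-a≥k with m≤n⇒m<n∨m≡n a≤k
    ... | inj₁ a<k  = <⇒≤ (ν.π″Perm-decreasing 1≤a a<k (≤-trans k≤b b≤r))
    ... | inj₂ refl = ≤-refl
    π₂-k≤b : at π₂ k ≤ at π₂ b
    π₂-k≤b with m≤n⇒m<n∨m≡n k≤b
    ... | inj₁ k<b  = <⇒≤ (μ.π′Perm-increasing (≤-trans 1≤a a≤k) k<b b≤r)
    ... | inj₂ refl = ≤-refl

  rect-Big : ∀ {x c} → 1 ≤ x → x ≤ r → r < c → c ≤ n → Big (x , c)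
  rect-Big 1≤x x≤r r<c c≤n =
    (1≤x , <-≤-trans (s≤s x≤r) r<c , ≤-trans c≤n (m≤m+n n N)) ,
    (λ (_ , inv) → <-asym inv (ν.π″Perm-zeros<range 1≤x x≤r r<c (≤-trans c≤n n≤r+N)))

module Moves (n l N : ℕ) (σ μ ν : List Bool) (f : Sq → Sq) where

  open Game n l N σ μ ν f

  movesTo-col-≥ : ∀ {st i j X Y} → MovesTo st i j X Y → j ≤ col Y
  movesTo-col-≥ (inj₁ (_ , j<b , refl) , _) = <⇒≤ j<b
  movesTo-col-≥ (inj₂ (_ , _ , refl) , _)   = ≤-refl

  movesTo-vertical : ∀ {st i j X Y} → MovesTo st i j X Y → i < col X → row X ≡ j × Y ≡ (i , col X)
  movesTo-vertical (inj₁ (a≡j , _ , Y≡) , _) _   = a≡j , Y≡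
  movesTo-vertical (inj₂ (b≡i , _ , _) , _)  i<b = ⊥-elim (<-irrefl (sym b≡i) i<b)

  module _ {mark st i j st′} (mv : Move mark st i j st′) {S} (S∈λ₁ : λ₁ S) where

    moved : ∀ {Y} → MovesTo st i j (pos st S) Y → (pos st′ S ≡ Y) × (placed st′ S ≡ (mark ∨ placed st S))
    moved = proj₁ (proj₂ mv S S∈λ₁) _

    stays : ¬ Σ Sq (MovesTo st i j (pos st S)) → (pos st′ S ≡ pos st S) × (placed st′ S ≡ placed st S)
    stays = proj₂ (proj₂ mv S S∈λ₁)

    -- Whether a token moves is undecidable (occupancy quantifies over all
    -- squares), so the two outcomes can only be split for decidable goals.
    by-outcome : ∀ {P : Set} → Dec P →
      (∀ {Y} → MovesTo st i j (pos st S) Y → pos st′ S ≡ Y → placed st′ S ≡ (mark ∨ placed st S) → P) →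
      (pos st′ S ≡ pos st S → placed st′ S ≡ placed st S → P) → P
    by-outcome P? if-moved if-stays = decidable-stable P? λ ¬P →
      ¬P (uncurry if-stays (stays λ (Y , m) → ¬P (uncurry (if-moved m) (moved m))))

module GRGA {n l N : ℕ} (l≤n : l ≤ n) (l≤N : l ≤ N) (σ μ ν : List Bool)
  (σ-ok : ZeroOneString n l σ) (μ-ok : ZeroOneString n l μ) (ν-ok : ZeroOneString n l ν)
  (f : Sq → Sq) (pic : Game.Picture n l N σ μ ν f) where

  open Game n l N σ μ ν f
  open Shape l≤n l≤N σ μ ν σ-ok μ-ok ν-ok f
  open Moves n l N σ μ ν f

  f-into-D : ∀ {S} → λ₁ S → D (f S)
  f-into-D = proj₁ pic _

  Graph : Sq → Sq → Set
  Graph A A′ = λ₁ A × f A ≡ A′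

  graph-picture : IsPicture λ₁ D Graph
  graph-picture = let (_ , _ , onto , lex , lex⁻¹) = pic in record
    { domain       = proj₁
    ; codomain     = λ { (A∈λ₁ , refl) → f-into-D A∈λ₁ }
    ; total        = λ A∈λ₁ → f _ , A∈λ₁ , refl
    ; onto         = λ B∈D → let (A , A∈λ₁ , fA≡B) = onto _ B∈D in A , A∈λ₁ , fA≡B
    ; lex-image    = λ { (A∈λ₁ , refl) (B∈λ₁ , refl) → lex _ _ A∈λ₁ B∈λ₁ }
    ; lex-preimage = λ { (A∈λ₁ , refl) (B∈λ₁ , refl) → lex⁻¹ _ _ A∈λ₁ B∈λ₁ }
    }

  module f   = PictureFacts graph-picture
  module f⁻¹ = PictureFacts (converse graph-picture)

  f-row≤row : ∀ {S} → λ₁ S → row (f S) ≤ row S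
  f-row≤row {a , c} S∈λ₁ with m≤n⇒m<n∨m≡n (proj₁ (proj₂ (λ₁-rect S∈λ₁)))
  ... | inj₂ refl = proj₁ (proj₂ (D-rect (f-into-D S∈λ₁)))
  ... | inj₁ a<r  = +-cancelʳ-≤ r _ _ (begin
    row (f (a , c)) + r ≤⟨ f.column-gap λ₁-column-convex (S∈λ₁ , refl) (bottom , refl) refl a<r ⟩
    row (f (r , c)) + a ≤⟨ +-monoˡ-≤ a (proj₁ (proj₂ (D-rect (f-into-D bottom)))) ⟩
    r + a               ≡⟨ +-comm r a ⟩
    a + r               ∎)
    where
    open ≤-Reasoning
    bottom : λ₁ (r , c)
    bottom = λ₁-down S∈λ₁ (<⇒≤ a<r) ≤-refl

  record Invariant (st : State) : Set where
    field
      rounds       : ℕ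
      row-unplaced : ∀ {S} → λ₁ S → Unplaced st S → row (pos st S) + rounds ≡ row S
      col-unplaced : ∀ {S} → λ₁ S → Unplaced st S → col (pos st S) ≡ col S
      rd-nonneg    : ∀ {S} → λ₁ S → Unplaced st S → row (f S) ≤ row (pos st S)
      col-placed   : ∀ {S} → λ₁ S → placed st S ≡ true → n < col (pos st S)

    rd-≤ : ∀ {S S′} → λ₁ S → λ₁ S′ → Unplaced st S → Unplaced st S′ →
           row S + row (f S′) ≤ row S′ + row (f S) → rd st S ℤ.≤ rd st S′
    rd-≤ {S} {S′} S∈λ₁ S′∈λ₁ S-un S′-un le =
      m-n≤o-p (row (pos st S)) (row (f S)) (row (pos st S′)) (row (f S′)) (+-cancelʳ-≤ rounds _ _ (begin
      row (pos st S) + row (f S′) + rounds  ≡⟨ xy∙z≈xz∙y (row (pos st S)) (row (f S′)) rounds ⟩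
      row (pos st S) + rounds + row (f S′)  ≡⟨ cong (_+ row (f S′)) (row-unplaced S∈λ₁ S-un) ⟩
      row S + row (f S′)                    ≤⟨ le ⟩
      row S′ + row (f S)                    ≡⟨ cong (_+ row (f S)) (row-unplaced S′∈λ₁ S′-un) ⟨
      row (pos st S′) + rounds + row (f S)  ≡⟨ xy∙z≈xz∙y (row (pos st S′)) rounds (row (f S)) ⟩
      row (pos st S′) + row (f S) + rounds  ∎))
      where open ≤-Reasoning

    original-row-≡ : ∀ {S S′} → λ₁ S → λ₁ S′ → Unplaced st S → Unplaced st S′ →
                     row (pos st S) ≡ row (pos st S′) → row S ≡ row S′
    original-row-≡ S∈λ₁ S′∈λ₁ S-un S′-un rows =
      trans (sym (row-unplaced S∈λ₁ S-un)) (trans (cong (_+ rounds) rows) (row-unplaced S′∈λ₁ S′-un))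

    original-row-< : ∀ {S S′} → λ₁ S → λ₁ S′ → Unplaced st S → Unplaced st S′ →
                     row (pos st S) < row (pos st S′) → row S < row S′
    original-row-< S∈λ₁ S′∈λ₁ S-un S′-un rows =
      subst₂ _<_ (row-unplaced S∈λ₁ S-un) (row-unplaced S′∈λ₁ S′-un) (+-monoˡ-< rounds rows)

    original-col-≡ : ∀ {S S′} → λ₁ S → λ₁ S′ → Unplaced st S → Unplaced st S′ →
                     col (pos st S) ≡ col (pos st S′) → col S ≡ col S′
    original-col-≡ S∈λ₁ S′∈λ₁ S-un S′-un = subst₂ _≡_ (col-unplaced S∈λ₁ S-un) (col-unplaced S′∈λ₁ S′-un)

    original-col-< : ∀ {S S′} → λ₁ S → λ₁ S′ → Unplaced st S → Unplaced st S′ →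
                     col (pos st S) < col (pos st S′) → col S < col S′
    original-col-< S∈λ₁ S′∈λ₁ S-un S′-un = subst₂ _<_ (col-unplaced S∈λ₁ S-un) (col-unplaced S′∈λ₁ S′-un)

  invariant-props : ∀ {st} → Invariant st → Props st
  invariant-props {st} inv = prop-a , prop-b , prop-c , prop-d
    where
    open Invariant inv

    prop-a : PropA st
    prop-a S S′ S∈ S′∈ S-un S′-un rows cols = rd-≤ S∈ S′∈ S-un S′-un
      (+-mono-≤ (≤-reflexive same-row)
                (f.row-antitone (S∈ , refl) (S′∈ , refl) same-row (original-col-< S∈ S′∈ S-un S′-un cols)))
      where
      same-row : row S ≡ row S′
      same-row = original-row-≡ S∈ S′∈ S-un S′-un rows

    prop-b : PropB st
    prop-b S S′ S∈ S′∈ S-un S′-un cols rows = rd-≤ S′∈ S∈ S′-un S-un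
      (subst₂ _≤_ (+-comm (row (f S)) (row S′)) (+-comm (row (f S′)) (row S))
        (f.column-gap λ₁-column-convex (S∈ , refl) (S′∈ , refl)
          (original-col-≡ S∈ S′∈ S-un S′-un cols) (original-row-< S∈ S′∈ S-un S′-un rows)))

    prop-c : PropC st
    prop-c S S′ S∈ S′∈ S-un S′-un _ _ rows cols = rd-≤ S′∈ S∈ S′-un S-un
      (+-mono-≤ (f⁻¹.row-antitone (S∈ , refl) (S′∈ , refl) rows cols) (≤-reflexive rows))

    prop-d : PropD st
    prop-d S S′ S∈ S′∈ S-un S′-un _ _ cols rows = rd-≤ S∈ S′∈ S-un S′-un
      (f⁻¹.column-gap D-column-convex (S∈ , refl) (S′∈ , refl) cols rows)

  invariant-initial : Invariant initial
  invariant-initial = record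
    { rounds       = 0
    ; row-unplaced = λ _ _ → +-identityʳ _
    ; col-unplaced = λ _ _ → refl
    ; rd-nonneg    = λ S∈λ₁ _ → f-row≤row S∈λ₁
    ; col-placed   = λ _ ()
    }

  invariant-place : ∀ {st st′ i j} → n < j → Move true st i j st′ → Invariant st → Invariant st′
  invariant-place {st} {st′} {i} {j} n<j mv inv = record
    { rounds       = rounds
    ; row-unplaced = λ S∈λ₁ S-un′ → trans (cong (λ X → row X + rounds) (unmoved S∈λ₁ S-un′))
                                          (row-unplaced S∈λ₁ (unplaced-before S∈λ₁ S-un′))
    ; col-unplaced = λ S∈λ₁ S-un′ → trans (cong col (unmoved S∈λ₁ S-un′))
                                          (col-unplaced S∈λ₁ (unplaced-before S∈λ₁ S-un′))
    ; rd-nonneg    = λ S∈λ₁ S-un′ → subst (λ X → row (f _) ≤ row X) (sym (unmoved S∈λ₁ S-un′))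
                                          (rd-nonneg S∈λ₁ (unplaced-before S∈λ₁ S-un′))
    ; col-placed   = col-placed′
    }
    where
    open Invariant inv

    no-move : ∀ {S} → λ₁ S → Unplaced st′ S → ¬ Σ Sq (MovesTo st i j (pos st S))
    no-move S∈λ₁ S-un′ (_ , m) = case trans (sym (proj₂ (moved mv S∈λ₁ m))) S-un′ of λ ()

    unmoved : ∀ {S} → λ₁ S → Unplaced st′ S → pos st′ S ≡ pos st S
    unmoved S∈λ₁ S-un′ = proj₁ (stays mv S∈λ₁ (no-move S∈λ₁ S-un′))

    unplaced-before : ∀ {S} → λ₁ S → Unplaced st′ S → Unplaced st S
    unplaced-before S∈λ₁ S-un′ = trans (sym (proj₂ (stays mv S∈λ₁ (no-move S∈λ₁ S-un′)))) S-un′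

    col-placed′ : ∀ {S} → λ₁ S → placed st′ S ≡ true → n < col (pos st′ S)
    col-placed′ {S} S∈λ₁ S-pl′ = by-outcome mv S∈λ₁ (n <? col (pos st′ S))
      (λ m pos≡ _ → subst (λ X → n < col X) (sym pos≡) (<-≤-trans n<j (movesTo-col-≥ {st} {i} m)))
      (λ pos≡ placed≡ → subst (λ X → n < col X) (sym pos≡) (col-placed S∈λ₁ (trans (sym placed≡) S-pl′)))

  module ShiftRound {st : State} (inv : Invariant st) (none-ready : ¬ Σ Sq (ReadyTok st)) where

    open Invariant inv

    strictly-below-target : ∀ {S} → λ₁ S → Unplaced st S → row (f S) < row (pos st S)
    strictly-below-target {S} S∈λ₁ S-un = ≤∧≢⇒< (rd-nonneg S∈λ₁ S-un) λ rows →
      none-ready (S , S∈λ₁ , S-un ,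
        trans (cong (λ x → ℤ.+ x ℤ.- ℤ.+ row (f S)) (sym rows)) (ℤ.+-inverseʳ (ℤ.+ row (f S))))

    unplaced-rect : ∀ {S} → λ₁ S → Unplaced st S →
                    2 ≤ row (pos st S) × row (pos st S) ≤ r × r < col (pos st S) × col (pos st S) ≤ n
    unplaced-rect {S} S∈λ₁ S-un with λ₁-rect S∈λ₁
    ... | _ , a≤r , r<c , c≤n =
      ≤-trans (s≤s (proj₁ (D-rect (f-into-D S∈λ₁)))) (strictly-below-target S∈λ₁ S-un) ,
      ≤-trans (m≤m+n _ rounds) (subst (_≤ r) (sym (row-unplaced S∈λ₁ S-un)) a≤r) ,
      subst (r <_) (sym (col-unplaced S∈λ₁ S-un)) r<c ,
      subst (_≤ n) (sym (col-unplaced S∈λ₁ S-un)) c≤n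

    r<col : ∀ {S} → λ₁ S → r < col (pos st S)
    r<col {S} S∈λ₁ with placed st S in S-pl
    ... | true  = ≤-<-trans (m∸n≤m n l) (col-placed S∈λ₁ S-pl)
    ... | false = proj₁ (proj₂ (proj₂ (unplaced-rect S∈λ₁ S-pl)))

    record Raised (k : ℕ) (s : State) : Set where
      field
        placed-same : ∀ {S} → λ₁ S → placed s S ≡ placed st S
        col-same    : ∀ {S} → λ₁ S → col (pos s S) ≡ col (pos st S)
        row-raised  : ∀ {S} → λ₁ S → Unplaced st S → RaisedUpTo k (row (pos st S)) (row (pos s S))

    raised-none : Raised 0 st
    raised-none = record
      { placed-same = λ _ → refl
      ; col-same    = λ _ → refl
      ; row-raised  = λ S∈λ₁ S-un → raised-start (proj₁ (unplaced-rect S∈λ₁ S-un))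
      }

    raised-more : ∀ {k s s′} → Raised k s → suc k < r → Move false s (suc k) (suc (suc k)) s′ →
                  Raised (suc k) s′
    raised-more {k} {s} {s′} R k+1<r mv = record
      { placed-same = λ S∈λ₁ → trans (placed-kept S∈λ₁) (placed-same S∈λ₁)
      ; col-same    = λ S∈λ₁ → trans (col-kept S∈λ₁) (col-same S∈λ₁)
      ; row-raised  = row-raised′
      }
      where
      open Raised R

      placed-kept : ∀ {S} → λ₁ S → placed s′ S ≡ placed s S
      placed-kept {S} S∈λ₁ = by-outcome mv S∈λ₁ (placed s′ S Bool.≟ placed s S) (λ _ _ p → p) (λ _ p → p)

      r<col-s : ∀ {S} → λ₁ S → r < col (pos s S)
      r<col-s S∈λ₁ = subst (r <_) (sym (col-same S∈λ₁)) (r<col S∈λ₁)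

      k+1<col : ∀ {S} → λ₁ S → suc k < col (pos s S)
      k+1<col S∈λ₁ = <-trans k+1<r (r<col-s S∈λ₁)

      col-kept : ∀ {S} → λ₁ S → col (pos s′ S) ≡ col (pos s S)
      col-kept {S} S∈λ₁ = by-outcome mv S∈λ₁ (col (pos s′ S) ≟ col (pos s S))
        (λ m pos≡ _ → cong col (trans pos≡ (proj₂ (movesTo-vertical {s} m (k+1<col S∈λ₁)))))
        (λ pos≡ _ → cong col pos≡)

      vacant : ∀ {S} → λ₁ S → row (pos s S) ≡ suc k → col (pos s S) ≤ n → ⊥
      vacant {S} S∈λ₁ row≡ col≤n with placed st S in S-pl
      ... | true  = <⇒≱ (subst (n <_) (sym (col-same S∈λ₁)) (col-placed S∈λ₁ S-pl)) col≤n
      ... | false = raised-avoids (proj₁ (unplaced-rect S∈λ₁ S-pl)) (row-raised S∈λ₁ S-pl) row≡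

      lift : ∀ {S} → λ₁ S → Unplaced st S → row (pos s S) ≡ suc (suc k) →
             MovesTo s (suc k) (suc (suc k)) (pos s S) (suc k , col (pos s S))
      lift {S} S∈λ₁ S-un row≡ =
        inj₁ (row≡ , ≤-<-trans k+1<r (r<col-s S∈λ₁) , refl) ,
        rect-Big (subst (1 ≤_) (sym row≡) (s≤s z≤n)) (subst (_≤ r) (sym row≡) k+1<r) (r<col-s S∈λ₁) col≤n ,
        rect-Big (s≤s z≤n) (<⇒≤ k+1<r) (r<col-s S∈λ₁) col≤n ,
        λ (S₂ , S₂∈λ₁ , pos≡) → vacant S₂∈λ₁ (cong row pos≡)
          (subst (_≤ n) (sym (cong col pos≡)) col≤n)
        where
        col≤n : col (pos s S) ≤ n
        col≤n = subst (_≤ n) (sym (col-same S∈λ₁)) (proj₂ (proj₂ (proj₂ (unplaced-rect S∈λ₁ S-un))))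

      row-raised′ : ∀ {S} → λ₁ S → Unplaced st S → RaisedUpTo (suc k) (row (pos st S)) (row (pos s′ S))
      row-raised′ {S} S∈λ₁ S-un with row (pos s S) ≟ suc (suc k)
      ... | yes row≡ = subst (RaisedUpTo (suc k) _) (cong row (sym (proj₁ (moved mv S∈λ₁ (lift S∈λ₁ S-un row≡)))))
                             (raised-move (subst (RaisedUpTo k _) row≡ (row-raised S∈λ₁ S-un)))
      ... | no row≢  = subst (RaisedUpTo (suc k) _) (cong row (sym (proj₁ (stays mv S∈λ₁ λ (_ , m) →
                               row≢ (proj₁ (movesTo-vertical {s} m (k+1<col S∈λ₁)))))))
                             (raised-stay (row-raised S∈λ₁ S-un) row≢)

    raised-shifts : ∀ {k s} → Shifts k st s → k ≤ r ∸ 1 → Raised k s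
    raised-shifts none             _    = raised-none
    raised-shifts (more shifts mv) k+1≤ = raised-more (raised-shifts shifts (<⇒≤ k+1≤)) (<∸1⇒suc< k+1≤) mv

    invariant-shift : ∀ {st′} → Shifts (r ∸ 1) st st′ → Invariant st′
    invariant-shift {st′} shifts = record
      { rounds       = suc rounds
      ; row-unplaced = λ {S} S∈λ₁ S-un′ → let S-un = unplaced-before S∈λ₁ S-un′ in begin
          row (pos st′ S) + suc rounds   ≡⟨ +-suc _ rounds ⟩
          suc (row (pos st′ S)) + rounds ≡⟨ cong (_+ rounds) (raised S∈λ₁ S-un) ⟩
          row (pos st S) + rounds        ≡⟨ row-unplaced S∈λ₁ S-un ⟩
          row S                          ∎
      ; col-unplaced = λ S∈λ₁ S-un′ → trans (col-same S∈λ₁) (col-unplaced S∈λ₁ (unplaced-before S∈λ₁ S-un′))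
      ; rd-nonneg    = λ S∈λ₁ S-un′ → let S-un = unplaced-before S∈λ₁ S-un′ in
          ≤-pred (subst (row (f _) <_) (sym (raised S∈λ₁ S-un)) (strictly-below-target S∈λ₁ S-un))
      ; col-placed   = λ S∈λ₁ S-pl′ → subst (n <_) (sym (col-same S∈λ₁))
                                        (col-placed S∈λ₁ (trans (sym (placed-same S∈λ₁)) S-pl′))
      }
      where
      open Raised (raised-shifts shifts ≤-refl)
      open ≡-Reasoning

      unplaced-before : ∀ {S} → λ₁ S → Unplaced st′ S → Unplaced st S
      unplaced-before S∈λ₁ S-un′ = trans (sym (placed-same S∈λ₁)) S-un′

      raised : ∀ {S} → λ₁ S → Unplaced st S → suc (row (pos st′ S)) ≡ row (pos st S)
      raised S∈λ₁ S-un = proj₁ (row-raised S∈λ₁ S-un)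
        (≤-trans (proj₁ (proj₂ (unplaced-rect S∈λ₁ S-un))) (m≤n+m∸n r 1))

  invariant-step : ∀ {st st′} → GStep st st′ → Invariant st → Invariant st′
  invariant-step (shift _ none-ready shifts) inv = ShiftRound.invariant-shift inv none-ready shifts
  invariant-step (place _ B _ ((B∈D , _) , _) _ _ _ _ mv) = invariant-place (proj₂ (proj₂ (D-rect B∈D))) mv

  invariant-reachable : ∀ {st st′} → Star GStep st st′ → Invariant st → Invariant st′
  invariant-reachable ε              inv = inv
  invariant-reachable (step ◅ steps) inv = invariant-reachable steps (invariant-step step inv)

lemma3p5 : (n l N : ℕ) → 1 ≤ n → l ≤ n → l ≤ N →
    (σ μ ν : List Bool) →
    ZeroOneString n l σ → ZeroOneString n l μ → ZeroOneString n l ν →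
    (f : Sq → Sq) →
    (∀ S → Game.λ₂ n l N σ μ ν f S → Game.λ̄₃ n l N σ μ ν f S) →
    Game.Picture n l N σ μ ν f →
    Game.Props n l N σ μ ν f (Game.initial n l N σ μ ν f)
    × (∀ st → Game.Reachable n l N σ μ ν f st → Game.Props n l N σ μ ν f st)
lemma3p5 n l N _ l≤n l≤N σ μ ν σ-ok μ-ok ν-ok f _ pic =
  invariant-props invariant-initial ,
  λ _ reachable → invariant-props (invariant-reachable reachable invariant-initial)
  where open GRGA l≤n l≤N σ μ ν σ-ok μ-ok ν-ok f pic
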